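{- Let $\mathcal{A}$ be a $\mathbf{tDL}$-algebra and $\{a_i\}_{i\in I}\subseteq A$ such that $\bigwedge_{i\in I}a_i$ and $\bigvee_{i\in I}a_i$ exist. Then the following meets and joins exist and: (i) $\bigwedge_i\mathbf{G}a_i=\mathbf{G}\bigwedge_i a_i$; (ii) $\bigwedge_i\mathbf{H}a_i=\mathbf{H}\bigwedge_ia_i$; (iii) $\bigwedge_i d a_i=d\bigwedge_i a_i$; (iv) $\bigvee_i\mathbf{F}a_i=\mathbf{F}\bigvee_ia_i$; (v) $\bigvee_i\mathbf{P}a_i=\mathbf{P}\bigvee_ia_i$; (vi) $\bigvee_i\hat{d}a_i=\hat{d}\bigvee_ia_i$.
   Context: A $\mathbf{tDL}$-algebra is a bounded distributive lattice $\langle A,\wedge,\vee,0,1\rangle$ with unary operators $\mathbf{G},\mathbf{H},\mathbf{F},\mathbf{P}$ such that for all $x,y$: $\mathbf{G}1=\mathbf{H}1=1$; $\mathbf{G},\mathbf{H}$ preserve $\wedge$; $x\le\mathbf{G}\mathbf{P}x$, $x\le\mathbf{H}\mathbf{F}x$; $\mathbf{G}(x\vee y)\le\mathbf{G}x\vee\mathbf{F}y$, $\mathbf{H}(x\vee y)\le\mathbf{H}x\vee\mathbf{P}y$; $\mathbf{F}0=\mathbf{P}0=0$; $\mathbf{F},\mathbf{P}$ preserve $\vee$; $\mathbf{P}\mathbf{G}x\le x$, $\mathbf{F}\mathbf{H}x\le x$; $\mathbf{G}x\wedge\mathbf{F}y\le\mathbf{F}(x\wedge y)$, $\mathbf{H}x\wedge\mathbf{P}y\le\mathbf{P}(x\wedge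 y)$. $dx=\mathbf{G}x\wedge x\wedge\mathbf{H}x$ and $\hat{d}x=\mathbf{F}x\vee x\vee\mathbf{P}x$. Meets and joins indexed by $I$ are taken in the lattice $A$. -}

module Defs where

open import Level using (Level; _⊔_; suc)
open import Data.Product using (Σ; _×_)
open import Algebra.Lattice.Bundles using (DistributiveLattice)
open import Algebra.Core using (Op₁)
open import Algebra.Definitions using (Congruent₁)

record TDLAlgebra (c ℓ : Level) : Set (suc (c ⊔ ℓ)) where
  field
    distLattice : DistributiveLattice c ℓ
  open DistributiveLattice distLattice public
  infix 4 _≤_
  _≤_ : Carrier → Carrier → Set ℓ
  x ≤ y = (x ∧ y) ≈ x
  field
    𝟘 𝟙 : Carrier
    𝟘-least    : ∀ x → 𝟘 ≤ x
    𝟙-greatest : ∀ x → x ≤ 𝟙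
    G H F P : Op₁ Carrier
    G-cong : Congruent₁ _≈_ G
    H-cong : Congruent₁ _≈_ H
    F-cong : Congruent₁ _≈_ F
    P-cong : Congruent₁ _≈_ P
    G1 : G 𝟙 ≈ 𝟙
    H1 : H 𝟙 ≈ 𝟙
    G-∧ : ∀ x y → G (x ∧ y) ≈ (G x ∧ G y)
    H-∧ : ∀ x y → H (x ∧ y) ≈ (H x ∧ H y)
    x≤GPx : ∀ x → x ≤ G (P x)
    x≤HFx : ∀ x → x ≤ H (F x)
    G-∨ : ∀ x y → G (x ∨ y) ≤ (G x ∨ F y)
    H-∨ : ∀ x y → H (x ∨ y) ≤ (H x ∨ P y)
    F0 : F 𝟘 ≈ 𝟘
    P0 : P 𝟘 ≈ 𝟘
    F-∨ : ∀ x y → F (x ∨ y) ≈ (F x ∨ F y)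
    P-∨ : ∀ x y → P (x ∨ y) ≈ (P x ∨ P y)
    PGx≤x : ∀ x → P (G x) ≤ x
    FHx≤x : ∀ x → F (H x) ≤ x
    G-F : ∀ x y → (G x ∧ F y) ≤ F (x ∧ y)
    H-P : ∀ x y → (H x ∧ P y) ≤ P (x ∧ y)

  d : Carrier → Carrier
  d x = G x ∧ (x ∧ H x)

  d̂ : Carrier → Carrier
  d̂ x = F x ∨ (x ∨ P x)

  IsMeet : ∀ {i} {I : Set i} → (I → Carrier) → Carrier → Set (i ⊔ c ⊔ ℓ)
  IsMeet {I = I} a m = (∀ j → m ≤ a j) × (∀ z → (∀ j → z ≤ a j) → z ≤ m)

  IsJoin : ∀ {i} {I : Set i} → (I → Carrier) → Carrier → Set (i ⊔ c ⊔ ℓ)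
  IsJoin {I = I} a m = (∀ j → a j ≤ m) × (∀ z → (∀ j → a j ≤ z) → m ≤ z)

  MeetIs : ∀ {i} {I : Set i} → (I → Carrier) → Carrier → Set (i ⊔ c ⊔ ℓ)
  MeetIs a e = Σ Carrier (λ m → IsMeet a m × m ≈ e)

  JoinIs : ∀ {i} {I : Set i} → (I → Carrier) → Carrier → Set (i ⊔ c ⊔ ℓ)
  JoinIs a e = Σ Carrier (λ m → IsJoin a m × m ≈ e)

{-# OPTIONS --safe #-}
-- G and H are the upper adjoints of P and F respectively (P x ≤ y ⇔ x ≤ G y
-- and F x ≤ y ⇔ x ≤ H y, from the unit and counit inequalities and
-- monotonicity), so G and H preserve all existing meets and F and P all
-- existing joins. Since d = G ∧ id ∧ H and d̂ = F ∨ id ∨ P, and meets of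
-- families commute with binary meets (dually for joins), (iii) and (vi)
-- follow from (i), (ii), (iv) and (v).
module Submission where

open import Defs
open import Level using (Level)
open import Data.Product using (_×_; _,_; proj₁; proj₂)
open import Function using (_∘_)
open import Algebra.Core using (Op₁)
open import Algebra.Definitions using (Congruent₁)
open import Relation.Binary.Definitions using (Adjoint)
open import Relation.Binary.Lattice using (module Lattice)
open import Algebra.Lattice.Properties.Lattice using (∨-∧-orderTheoreticLattice)
import Relation.Binary.Lattice.Properties.JoinSemilattice as JoinSemilatticeProperties

module TDLAlgebraProperties {c ℓ : Level} (𝒜 : TDLAlgebra c ℓ) where
  open TDLAlgebra 𝒜

  -- The library's natural order is x ≈ x ∧ y, the symmetric form of _≤_.
  private
    module O = Lattice (∨-∧-orderTheoreticLattice lattice)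
    module J = JoinSemilatticeProperties O.joinSemilattice

  ≤-refl : ∀ {x} → x ≤ x
  ≤-refl = sym O.refl

  ≤-trans : ∀ {x y z} → x ≤ y → y ≤ z → x ≤ z
  ≤-trans x≤y y≤z = sym (O.trans (sym x≤y) (sym y≤z))

  ≈⇒≤ : ∀ {x y} → x ≈ y → x ≤ y
  ≈⇒≤ x≈y = sym (O.reflexive x≈y)

  x∧y≤x : ∀ x y → x ∧ y ≤ x
  x∧y≤x x y = sym (O.x∧y≤x x y)

  x∧y≤y : ∀ x y → x ∧ y ≤ y
  x∧y≤y x y = sym (O.x∧y≤y x y)

  ∧-greatest : ∀ {x y z} → x ≤ y → x ≤ z → x ≤ y ∧ z
  ∧-greatest x≤y x≤z = sym (O.∧-greatest (sym x≤y) (sym x≤z))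

  x≤x∨y : ∀ x y → x ≤ x ∨ y
  x≤x∨y x y = sym (O.x≤x∨y x y)

  y≤x∨y : ∀ x y → y ≤ x ∨ y
  y≤x∨y x y = sym (O.y≤x∨y x y)

  ∨-least : ∀ {x y z} → x ≤ z → y ≤ z → x ∨ y ≤ z
  ∨-least x≤z y≤z = sym (O.∨-least (sym x≤z) (sym y≤z))

  x≤y⇒x∨y≈y : ∀ {x y} → x ≤ y → x ∨ y ≈ y
  x≤y⇒x∨y≈y x≤y = J.x≤y⇒x∨y≈y (sym x≤y)

  ∧-homomorphism⇒monotone : ∀ {f : Op₁ Carrier} → Congruent₁ _≈_ f →
    (∀ x y → f (x ∧ y) ≈ f x ∧ f y) → ∀ {x y} → x ≤ y → f x ≤ f y
  ∧-homomorphism⇒monotone f-cong f-∧ {x} {y} x≤y = trans (sym (f-∧ x y)) (f-cong x≤y)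

  ∨-homomorphism⇒monotone : ∀ {f : Op₁ Carrier} → Congruent₁ _≈_ f →
    (∀ x y → f (x ∨ y) ≈ f x ∨ f y) → ∀ {x y} → x ≤ y → f x ≤ f y
  ∨-homomorphism⇒monotone {f} f-cong f-∨ {x} {y} x≤y =
    ≤-trans (x≤x∨y (f x) (f y)) (≈⇒≤ (trans (sym (f-∨ x y)) (f-cong (x≤y⇒x∨y≈y x≤y))))

  G-mono : ∀ {x y} → x ≤ y → G x ≤ G y
  G-mono = ∧-homomorphism⇒monotone G-cong G-∧

  H-mono : ∀ {x y} → x ≤ y → H x ≤ H y
  H-mono = ∧-homomorphism⇒monotone H-cong H-∧

  F-mono : ∀ {x y} → x ≤ y → F x ≤ F y
  F-mono = ∨-homomorphism⇒monotone F-cong F-∨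

  P-mono : ∀ {x y} → x ≤ y → P x ≤ P y
  P-mono = ∨-homomorphism⇒monotone P-cong P-∨

  P⊣G : Adjoint _≤_ _≤_ P G
  P⊣G = (λ Px≤y → ≤-trans (x≤GPx _) (G-mono Px≤y))
      , (λ x≤Gy → ≤-trans (P-mono x≤Gy) (PGx≤x _))

  F⊣H : Adjoint _≤_ _≤_ F H
  F⊣H = (λ Fx≤y → ≤-trans (x≤HFx _) (H-mono Fx≤y))
      , (λ x≤Hy → ≤-trans (F-mono x≤Hy) (FHx≤x _))

  module _ {f g : Op₁ Carrier} (f⊣g : Adjoint _≤_ _≤_ f g) where

    upper-adjoint-preserves-meet : ∀ {i} {I : Set i} {a : I → Carrier} {m} →
      IsMeet a m → IsMeet (g ∘ a) (g m)
    upper-adjoint-preserves-meet {m = m} (lb , glb) =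
        (λ k → proj₁ f⊣g (≤-trans fgm≤m (lb k)))
      , (λ z z≤ga → proj₁ f⊣g (glb (f z) (λ k → proj₂ f⊣g (z≤ga k))))
      where
      fgm≤m : f (g m) ≤ m
      fgm≤m = proj₂ f⊣g ≤-refl

    lower-adjoint-preserves-join : ∀ {i} {I : Set i} {a : I → Carrier} {j} →
      IsJoin a j → IsJoin (f ∘ a) (f j)
    lower-adjoint-preserves-join {j = j} (ub , lub) =
        (λ k → proj₂ f⊣g (≤-trans (ub k) j≤gfj))
      , (λ z fa≤z → proj₂ f⊣g (lub (g z) (λ k → proj₁ f⊣g (fa≤z k))))
      where
      j≤gfj : j ≤ g (f j)
      j≤gfj = proj₁ f⊣g ≤-refl

  IsMeet-∧ : ∀ {i} {I : Set i} {a b : I → Carrier} {m n} →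
    IsMeet a m → IsMeet b n → IsMeet (λ k → a k ∧ b k) (m ∧ n)
  IsMeet-∧ {m = m} {n} (lb₁ , glb₁) (lb₂ , glb₂) =
      (λ k → ∧-greatest (≤-trans (x∧y≤x m n) (lb₁ k)) (≤-trans (x∧y≤y m n) (lb₂ k)))
    , (λ z z≤ab → ∧-greatest (glb₁ z (λ k → ≤-trans (z≤ab k) (x∧y≤x _ _)))
                             (glb₂ z (λ k → ≤-trans (z≤ab k) (x∧y≤y _ _))))

  IsJoin-∨ : ∀ {i} {I : Set i} {a b : I → Carrier} {j₁ j₂} →
    IsJoin a j₁ → IsJoin b j₂ → IsJoin (λ k → a k ∨ b k) (j₁ ∨ j₂)
  IsJoin-∨ {j₁ = j₁} {j₂} (ub₁ , lub₁) (ub₂ , lub₂) =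
      (λ k → ∨-least (≤-trans (ub₁ k) (x≤x∨y j₁ j₂)) (≤-trans (ub₂ k) (y≤x∨y j₁ j₂)))
    , (λ z ab≤z → ∨-least (lub₁ z (λ k → ≤-trans (x≤x∨y _ _) (ab≤z k)))
                          (lub₂ z (λ k → ≤-trans (y≤x∨y _ _) (ab≤z k))))

  IsMeet⇒MeetIs : ∀ {i} {I : Set i} {a : I → Carrier} {m} → IsMeet a m → MeetIs a m
  IsMeet⇒MeetIs meet = _ , meet , refl

  IsJoin⇒JoinIs : ∀ {i} {I : Set i} {a : I → Carrier} {j} → IsJoin a j → JoinIs a j
  IsJoin⇒JoinIs join = _ , join , refl

proposition2p27 : ∀ {c ℓ i : Level} (𝒜 : TDLAlgebra c ℓ) {I : Set i}
    (a : I → TDLAlgebra.Carrier 𝒜) (m j : TDLAlgebra.Carrier 𝒜) →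
    TDLAlgebra.IsMeet 𝒜 a m → TDLAlgebra.IsJoin 𝒜 a j →
    let open TDLAlgebra 𝒜 in
    MeetIs (λ k → G (a k)) (G m)
    × MeetIs (λ k → H (a k)) (H m)
    × MeetIs (λ k → d (a k)) (d m)
    × JoinIs (λ k → F (a k)) (F j)
    × JoinIs (λ k → P (a k)) (P j)
    × JoinIs (λ k → d̂ (a k)) (d̂ j)
proposition2p27 𝒜 a m j meet join =
    IsMeet⇒MeetIs G-meet
  , IsMeet⇒MeetIs H-meet
  , IsMeet⇒MeetIs (IsMeet-∧ G-meet (IsMeet-∧ meet H-meet))
  , IsJoin⇒JoinIs F-join
  , IsJoin⇒JoinIs P-join
  , IsJoin⇒JoinIs (IsJoin-∨ F-join (IsJoin-∨ join P-join))
  where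
  open TDLAlgebra 𝒜
  open TDLAlgebraProperties 𝒜

  G-meet : IsMeet (G ∘ a) (G m)
  G-meet = upper-adjoint-preserves-meet P⊣G meet

  H-meet : IsMeet (H ∘ a) (H m)
  H-meet = upper-adjoint-preserves-meet F⊣H meet

  F-join : IsJoin (F ∘ a) (F j)
  F-join = lower-adjoint-preserves-join F⊣H join

  P-join : IsJoin (P ∘ a) (P j)
  P-join = lower-adjoint-preserves-join P⊣G join
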